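{- Let $\Gamma=(V,E)$ be a connected simple graph of order $n$, size $m$ and diameter $D(\Gamma)$, and let ${\cal L}(\Gamma)$ be its line graph. Then $$\gamma_{ca}(\Gamma)\ge\left\lceil\sqrt{D(\Gamma)+n}-1\right\rceil\quad\text{and}\quad \gamma_{ca}({\cal L}(\Gamma))\ge\left\lceil\sqrt{D(\Gamma)+m-1}-1\right\rceil.$$
   Context: For a graph $G=(V,E)$, a set $S\subseteq V$ and a vertex $v$, let $N_S(v)$ be the set of neighbours of $v$ in $S$ and $N_{V\setminus S}(v)$ the set of neighbours of $v$ in $V\setminus S$. A nonempty set $S\subseteq V$ is a defensive alliance if $|N_S(v)|+1\ge |N_{V\setminus S}(v)|$ for every $v\in S$. A defensive alliance $S$ is global if every vertex of $V\setminus S$ is adjacent to at least one vertex of $S$. The global-connected defensive alliance number $\gamma_{ca}(G)$ is the minimum cardinality of a global defensive alliance $S$ in $G$ whose induced subgraph $\langle S\rangle$ is connected. The line graph ${\cal L}(\Gamma)$ has the edges of $\Gamma$ as vertices, two being adjacent when they share an endpoint. -}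

module Defs where

open import Data.Nat using (ℕ; zero; suc; _+_; _*_; _∸_; _≤_; _<_)
open import Data.Bool using (Bool; true; false; T)
open import Data.Fin using (Fin) renaming (_<_ to _<ᶠ_)
open import Data.Fin.Subset using (Subset; _∈_; _∉_; ∁; _∩_; ∣_∣)
open import Data.Vec using (tabulate)
open import Data.Product using (Σ; Σ-syntax; ∃; ∃-syntax; _×_; _,_; proj₁; proj₂)
open import Data.Sum using (_⊎_)
open import Relation.Binary.PropositionalEquality using (_≡_; _≢_)
open import Relation.Nullary using (¬_)
open import Function.Bundles using (_↔_; _⇔_)

record Graph (n : ℕ) : Set where
  field
    adj    : Fin n → Fin n → Bool
    sym    : ∀ i j → adj i j ≡ adj j i
    irrefl : ∀ i → adj i i ≡ false
open Graph public

Adj : ∀ {n} → Graph n → Fin n → Fin n → Set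
Adj G u v = T (adj G u v)

N : ∀ {n} → Graph n → Fin n → Subset n
N G v = tabulate (adj G v)

data Walk {n} (G : Graph n) : Fin n → Fin n → ℕ → Set where
  here : ∀ {u} → Walk G u u zero
  step : ∀ {u w v k} → Adj G u w → Walk G w v k → Walk G u v (suc k)

Connected : ∀ {n} → Graph n → Set
Connected G = ∀ u v → ∃[ k ] Walk G u v k

IsDist : ∀ {n} → Graph n → Fin n → Fin n → ℕ → Set
IsDist G u v d = Walk G u v d × (∀ k → Walk G u v k → d ≤ k)

IsDiameter : ∀ {n} → Graph n → ℕ → Set
IsDiameter G D =
  (∃[ u ] ∃[ v ] IsDist G u v D) × (∀ u v d → IsDist G u v d → d ≤ D)

DefensiveAlliance : ∀ {n} → Graph n → Subset n → Set
DefensiveAlliance G S =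
  (∃[ v ] v ∈ S) ×
  (∀ v → v ∈ S → ∣ ∁ S ∩ N G v ∣ ≤ ∣ S ∩ N G v ∣ + 1)

Global : ∀ {n} → Graph n → Subset n → Set
Global G S = ∀ v → v ∉ S → ∃[ u ] (u ∈ S × Adj G u v)

data WalkIn {n} (G : Graph n) (S : Subset n) : Fin n → Fin n → Set where
  here : ∀ {u} → u ∈ S → WalkIn G S u u
  step : ∀ {u w v} → u ∈ S → Adj G u w → WalkIn G S w v → WalkIn G S u v

InducedConnected : ∀ {n} → Graph n → Subset n → Set
InducedConnected G S = ∀ u v → u ∈ S → v ∈ S → WalkIn G S u v

GlobalConnectedDefensiveAlliance : ∀ {n} → Graph n → Subset n → Set
GlobalConnectedDefensiveAlliance G S =
  DefensiveAlliance G S × Global G S × InducedConnected G S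

-- γ_ca(G) ≥ b  ⇔  every global connected defensive alliance has size ≥ b.
GammaCaAtLeast : ∀ {n} → Graph n → ℕ → Set
GammaCaAtLeast G b = ∀ S → GlobalConnectedDefensiveAlliance G S → b ≤ ∣ S ∣

IsCeilSqrt : ℕ → ℕ → Set
IsCeilSqrt x k = x ≤ k * k × (∀ j → x ≤ j * j → k ≤ j)

Edge : ∀ {n} → Graph n → Set
Edge G = Σ[ p ∈ Fin _ × Fin _ ] (proj₁ p <ᶠ proj₂ p × Adj G (proj₁ p) (proj₂ p))

ShareEndpoint : ∀ {n} {G : Graph n} → Edge G → Edge G → Set
ShareEndpoint ((a , b) , _) ((c , d) , _) =
  (a ≡ c ⊎ a ≡ d) ⊎ (b ≡ c ⊎ b ≡ d)

-- L (on Fin m) is the line graph of G via the enumeration e : Fin m ↔ Edge G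
-- (so m is the size of G).
IsLineGraphVia : ∀ {n m} (G : Graph n) → Graph m → (Fin m ↔ Edge G) → Set
IsLineGraphVia G L e =
  ∀ i j → Adj L i j ⇔ (i ≢ j × ShareEndpoint {G = G} (to i) (to j))
  where open Function.Bundles.Inverse e

{-# OPTIONS --safe #-}

-- Let s = ∣ S ∣. Every v ∈ S has fewer than s neighbours in S, hence at most s outside it, and
-- the outside neighbours of S cover V ∖ S, so the order is at most s + s². Every vertex is S or
-- adjacent to S, and a shortest walk inside the connected ⟨S⟩ has fewer than s edges, so
-- D ≤ s + 1 and D + n ≤ (s + 1)². In the line graph, a walk of l edges of L lifts to a walk of
-- at most l + 1 edges of Γ between endpoints of its first and last edge; with one extra step at
-- each end this gives D ≤ s + 2, and with m ≤ s + s² again D + m − 1 ≤ (s + 1)².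
module Submission where

open import Defs
open import Data.Nat using (ℕ; zero; suc; _+_; _*_; _∸_; _≤_; _<_; z≤n; s≤s)
open import Data.Nat.Properties
  using (≤-refl; ≤-trans; ≤-reflexive; ≤-pred; n≮0; m≤n⇒m≤1+n; +-mono-≤; +-monoʳ-≤; +-comm; +-suc; *-suc; m+[n∸m]≡n; ∸-monoˡ-≤; module ≤-Reasoning)
open import Data.Bool using (true; false; T)
open import Data.Bool.Properties using (T-≡)
open import Data.Fin using (Fin; zero; suc; _≟_)
open import Data.Fin.Properties using (<-cmp)
open import Data.Fin.Subset using (Subset; Empty; _∈_; _∉_; _⊆_; ∁; _∩_; _-_; ∣_∣)
open import Data.Fin.Subset.Properties
  using (Empty-unique; ∣⊥∣≡0; ∣p∣≤n; ∣∁p∣≡n∸∣p∣; p⊆q⇒∣p∣≤∣q∣; x∈p⇒∣p-x∣<∣p∣; x∈p∧x≢y⇒x∈p-y; x∈p∩q⁺; x∈p∩q⁻; x∈∁p⇒x∉p; _∈?_)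
open import Data.Vec using (_∷_; []; here; there)
open import Data.Vec.Properties using (lookup∘tabulate; []=⇒lookup; lookup⇒[]=)
open import Data.Product using (∃-syntax; _×_; _,_; proj₂)
open import Data.Sum using (_⊎_; inj₁; inj₂)
open import Data.Empty using (⊥-elim)
open import Relation.Nullary using (yes; no)
open import Relation.Binary using (tri<; tri≈; tri>)
open import Relation.Binary.PropositionalEquality using (_≡_; _≢_; refl; cong; trans; subst; ≢-sym)
  renaming (sym to ≡-sym)
open import Function using (_∘_)
open import Function.Bundles using (_↔_; Inverse; Equivalence)

∣p∣≤∣q∣+∣p∩∁q∣ : ∀ {n} (p q : Subset n) → ∣ p ∣ ≤ ∣ q ∣ + ∣ p ∩ ∁ q ∣
∣p∣≤∣q∣+∣p∩∁q∣ []          []          = z≤n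
∣p∣≤∣q∣+∣p∩∁q∣ (true ∷ p)  (true ∷ q)  = s≤s (∣p∣≤∣q∣+∣p∩∁q∣ p q)
∣p∣≤∣q∣+∣p∩∁q∣ (true ∷ p)  (false ∷ q) =
  ≤-trans (s≤s (∣p∣≤∣q∣+∣p∩∁q∣ p q)) (≤-reflexive (≡-sym (+-suc ∣ q ∣ _)))
∣p∣≤∣q∣+∣p∩∁q∣ (false ∷ p) (true ∷ q)  = m≤n⇒m≤1+n (∣p∣≤∣q∣+∣p∩∁q∣ p q)
∣p∣≤∣q∣+∣p∩∁q∣ (false ∷ p) (false ∷ q) = ∣p∣≤∣q∣+∣p∩∁q∣ p q

∣covered∣≤∣S∣*c : ∀ {n m c} (S : Subset n) (f : Fin n → Subset m) {T : Subset m} →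
  (∀ {a} → a ∈ S → ∣ f a ∣ ≤ c) → (∀ {x} → x ∈ T → ∃[ a ] (a ∈ S × x ∈ f a)) →
  ∣ T ∣ ≤ ∣ S ∣ * c
∣covered∣≤∣S∣*c {m = m} [] f {T} _ covered =
  ≤-reflexive (trans (cong ∣_∣ (Empty-unique uncovered)) (∣⊥∣≡0 m))
  where
  uncovered : Empty T
  uncovered (_ , x∈T) with covered x∈T
  ... | () , _
∣covered∣≤∣S∣*c (false ∷ S) f {T} small covered =
  ∣covered∣≤∣S∣*c S (f ∘ suc) (small ∘ there) coveredByTail
  where
  coveredByTail : ∀ {x} → x ∈ T → ∃[ a ] (a ∈ S × x ∈ f (suc a))
  coveredByTail x∈T with covered x∈T
  ... | suc a , there a∈S , x∈fa = a , a∈S , x∈fa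
∣covered∣≤∣S∣*c (true ∷ S) f {T} small covered =
  ≤-trans (∣p∣≤∣q∣+∣p∩∁q∣ T (f zero))
          (+-mono-≤ (small here) (∣covered∣≤∣S∣*c S (f ∘ suc) (small ∘ there) restCovered))
  where
  restCovered : ∀ {x} → x ∈ T ∩ ∁ (f zero) → ∃[ a ] (a ∈ S × x ∈ f (suc a))
  restCovered x∈rest with x∈p∩q⁻ T (∁ (f zero)) x∈rest
  ... | x∈T , x∈∁f0 with covered x∈T
  ...   | zero , _ , x∈f0 = ⊥-elim (x∈∁p⇒x∉p x∈∁f0 x∈f0)
  ...   | suc a , there a∈S , x∈fa = a , a∈S , x∈fa

module _ {n} (G : Graph n) where

  Adj-sym : ∀ {u v} → Adj G u v → Adj G v u
  Adj-sym {u} {v} = subst T (Graph.sym G u v)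

  Adj⇒∈N : ∀ {v x} → Adj G v x → x ∈ N G v
  Adj⇒∈N {v} {x} v~x =
    lookup⇒[]= x (N G v) (trans (lookup∘tabulate (adj G v) x) (Equivalence.to T-≡ v~x))

  v∉N[v] : ∀ v → v ∉ N G v
  v∉N[v] v v∈N with trans (≡-sym ([]=⇒lookup v∈N)) (trans (lookup∘tabulate (adj G v) v) (irrefl G v))
  ... | ()

  ∣S∩N[v]∣<∣S∣ : ∀ {S v} → v ∈ S → ∣ S ∩ N G v ∣ < ∣ S ∣
  ∣S∩N[v]∣<∣S∣ {S} {v} v∈S = ≤-trans (s≤s (p⊆q⇒∣p∣≤∣q∣ S∩N[v]⊆S-v)) (x∈p⇒∣p-x∣<∣p∣ v∈S)
    where
    S∩N[v]⊆S-v : S ∩ N G v ⊆ S - v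
    S∩N[v]⊆S-v x∈ with x∈p∩q⁻ S (N G v) x∈
    ... | x∈S , x∈N = x∈p∧x≢y⇒x∈p-y x∈S λ { refl → v∉N[v] v x∈N }

  order≤∣S∣+∣S∣² : ∀ {S} → DefensiveAlliance G S → Global G S → n ≤ ∣ S ∣ + ∣ S ∣ * ∣ S ∣
  order≤∣S∣+∣S∣² {S} (_ , defends) global = begin
    n                   ≡⟨ ≡-sym (m+[n∸m]≡n (∣p∣≤n S)) ⟩
    ∣ S ∣ + (n ∸ ∣ S ∣) ≡⟨ cong (∣ S ∣ +_) (≡-sym (∣∁p∣≡n∸∣p∣ S)) ⟩
    ∣ S ∣ + ∣ ∁ S ∣     ≤⟨ +-monoʳ-≤ ∣ S ∣ (∣covered∣≤∣S∣*c S (λ a → ∁ S ∩ N G a) attackers≤ attacked) ⟩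
    ∣ S ∣ + ∣ S ∣ * ∣ S ∣ ∎
    where
    open ≤-Reasoning
    attackers≤ : ∀ {v} → v ∈ S → ∣ ∁ S ∩ N G v ∣ ≤ ∣ S ∣
    attackers≤ {v} v∈S =
      ≤-trans (defends v v∈S) (≤-trans (≤-reflexive (+-comm _ 1)) (∣S∩N[v]∣<∣S∣ v∈S))
    attacked : ∀ {x} → x ∈ ∁ S → ∃[ a ] (a ∈ S × x ∈ ∁ S ∩ N G a)
    attacked {x} x∈∁S with global x (x∈∁p⇒x∉p x∈∁S)
    ... | a , a∈S , a~x = a , a∈S , x∈p∩q⁺ (x∈∁S , Adj⇒∈N a~x)

module Walks {n} (G : Graph n) where

  _++ʷ_ : ∀ {u w v k l} → Walk G u w k → Walk G w v l → Walk G u v (k + l)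
  here        ++ʷ q = q
  step u~w p  ++ʷ q = step u~w (p ++ʷ q)

  Walk≤ : Fin n → Fin n → ℕ → Set
  Walk≤ u v b = ∃[ l ] (Walk G u v l × l ≤ b)

  _++≤_ : ∀ {u w v b c} → Walk≤ u w b → Walk≤ w v c → Walk≤ u v (b + c)
  (k , p , k≤b) ++≤ (l , q , l≤c) = k + l , p ++ʷ q , +-mono-≤ k≤b l≤c

  Walk≤-weaken : ∀ {u v b c} → b ≤ c → Walk≤ u v b → Walk≤ u v c
  Walk≤-weaken b≤c (l , p , l≤b) = l , p , ≤-trans l≤b b≤c

  Walk-lastStep : ∀ {u v k} → Walk G u v (suc k) → ∃[ y ] Adj G y v
  Walk-lastStep (step y~v here)         = _ , y~v
  Walk-lastStep (step _ (step w~y rest)) = Walk-lastStep (step w~y rest)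

  Near : Fin n → Fin n → Set
  Near x z = x ≡ z ⊎ Adj G x z

  Near-sym : ∀ {x z} → Near x z → Near z x
  Near-sym (inj₁ refl) = inj₁ refl
  Near-sym (inj₂ x~z)  = inj₂ (Adj-sym G x~z)

  Near⇒Walk≤1 : ∀ {x z} → Near x z → Walk≤ x z 1
  Near⇒Walk≤1 (inj₁ refl) = 0 , here , z≤n
  Near⇒Walk≤1 (inj₂ x~z)  = 1 , step x~z here , ≤-refl

  Global⇒Near : ∀ {S} → Global G S → ∀ x → ∃[ a ] (a ∈ S × Near x a)
  Global⇒Near {S} global x with x ∈? S
  ... | yes x∈S = x , x∈S , inj₁ refl
  ... | no x∉S with global x x∉S
  ...   | a , a∈S , a~x = a , a∈S , inj₂ (Adj-sym G a~x)

  WalkIn-head : ∀ {S u v} → WalkIn G S u v → u ∈ S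
  WalkIn-head (here u∈S)     = u∈S
  WalkIn-head (step u∈S _ _) = u∈S

  avoidOrLeave : ∀ {S u b} x → x ≢ b → WalkIn G S u b →
    WalkIn G (S - x) u b ⊎ ∃[ w ] (Adj G x w × WalkIn G (S - x) w b)
  avoidOrLeave x x≢b (here b∈S) = inj₁ (here (x∈p∧x≢y⇒x∈p-y b∈S (≢-sym x≢b)))
  avoidOrLeave {u = u} x x≢b (step u∈S u~w rest) with avoidOrLeave x x≢b rest
  ... | inj₂ leave = inj₂ leave
  ... | inj₁ rest′ with u ≟ x
  ...   | yes refl = inj₂ (_ , u~w , rest′)
  ...   | no u≢x   = inj₁ (step (x∈p∧x≢y⇒x∈p-y u∈S u≢x) u~w rest′)

  lastDeparture : ∀ {S a b} → a ≢ b → WalkIn G S a b → ∃[ w ] (Adj G a w × WalkIn G (S - a) w b)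
  lastDeparture a≢b (here _) = ⊥-elim (a≢b refl)
  lastDeparture a≢b (step _ a~w rest) with avoidOrLeave _ a≢b rest
  ... | inj₁ rest′ = _ , a~w , rest′
  ... | inj₂ leave = leave

  WalkIn⇒Walk< : ∀ {S a b} → WalkIn G S a b → ∃[ l ] (Walk G a b l × l < ∣ S ∣)
  WalkIn⇒Walk< {S} = shorten ∣ S ∣ ≤-refl
    where
    -- Recursion on the fuel k ≥ ∣ S ∣: after its last departure from a, the walk avoids a.
    shorten : ∀ k {S a b} → ∣ S ∣ ≤ k → WalkIn G S a b → ∃[ l ] (Walk G a b l × l < ∣ S ∣)
    shorten k {a = a} {b} ∣S∣≤k w with a ≟ b | x∈p⇒∣p-x∣<∣p∣ (WalkIn-head w)
    ... | yes refl | ∣S-a∣<∣S∣ = 0 , here , ≤-trans (s≤s z≤n) ∣S-a∣<∣S∣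
    ... | no a≢b   | ∣S-a∣<∣S∣ with k | lastDeparture a≢b w
    ...   | zero   | _ = ⊥-elim (n≮0 (≤-trans ∣S-a∣<∣S∣ ∣S∣≤k))
    ...   | suc k′ | c , a~c , w′ with shorten k′ (≤-pred (≤-trans ∣S-a∣<∣S∣ ∣S∣≤k)) w′
    ...     | l , p , l<∣S-a∣ = suc l , step a~c p , ≤-trans (s≤s l<∣S-a∣) ∣S-a∣<∣S∣

  globalConnected⇒Walk≤ : ∀ {S} → Global G S → InducedConnected G S →
    ∀ u v → Walk≤ u v (suc ∣ S ∣)
  globalConnected⇒Walk≤ {S} global connected u v
    with Global⇒Near global u | Global⇒Near global v
  ... | a , a∈S , u~a | b , b∈S , v~b with WalkIn⇒Walk< (connected a b a∈S b∈S)
  ...   | l , p , l<∣S∣ =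
    Walk≤-weaken (s≤s (≤-trans (≤-reflexive (+-comm l 1)) l<∣S∣))
      ((Near⇒Walk≤1 u~a ++≤ (l , p , ≤-refl)) ++≤ Near⇒Walk≤1 (Near-sym v~b))

  diameter≤ : ∀ {D b} → IsDiameter G D → (∀ {u v} → Walk G u v D → Walk≤ u v b) → D ≤ b
  diameter≤ ((_ , _ , p , shortest) , _) bound with bound p
  ... | l , q , l≤b = ≤-trans (shortest l q) l≤b

IsCeilSqrt⇒∸1≤ : ∀ {x k s} → IsCeilSqrt x k → x ≤ suc s * suc s → k ∸ 1 ≤ s
IsCeilSqrt⇒∸1≤ {s = s} (_ , least) x≤ = ∸-monoˡ-≤ 1 (least (suc s) x≤)

suc[s]+s+s*s≡suc[s]² : ∀ s → suc s + (s + s * s) ≡ suc s * suc s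
suc[s]+s+s*s≡suc[s]² s = cong (suc s +_) (≡-sym (*-suc s s))

γca≥⌈√[D+n]⌉∸1 : ∀ {n} (G : Graph n) {D} → IsDiameter G D →
  ∀ k → IsCeilSqrt (D + n) k → GammaCaAtLeast G (k ∸ 1)
γca≥⌈√[D+n]⌉∸1 {n} G {D} diameter k ceil S (alliance , global , connected) =
  IsCeilSqrt⇒∸1≤ ceil (begin
    D + n                             ≤⟨ +-mono-≤ D≤1+∣S∣ (order≤∣S∣+∣S∣² G alliance global) ⟩
    suc ∣ S ∣ + (∣ S ∣ + ∣ S ∣ * ∣ S ∣) ≡⟨ suc[s]+s+s*s≡suc[s]² ∣ S ∣ ⟩
    suc ∣ S ∣ * suc ∣ S ∣             ∎)
  where
  open ≤-Reasoning
  open Walks G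
  D≤1+∣S∣ : D ≤ suc ∣ S ∣
  D≤1+∣S∣ = diameter≤ diameter λ {u} {v} _ → globalConnected⇒Walk≤ global connected u v

module LineGraph {n m} (Γ : Graph n) (L : Graph m) (e : Fin m ↔ Edge Γ)
                 (isLine : IsLineGraphVia Γ L e) where
  open Inverse e using (to; from; strictlyInverseˡ)
  open Walks Γ

  Endpoint : Fin n → Edge Γ → Set
  Endpoint z ((p , q) , _) = z ≡ p ⊎ z ≡ q

  ShareEndpoint⇒commonEndpoint : ∀ e₁ e₂ → ShareEndpoint {G = Γ} e₁ e₂ →
    ∃[ z ] (Endpoint z e₁ × Endpoint z e₂)
  ShareEndpoint⇒commonEndpoint ((a , b) , _) _ (inj₁ (inj₁ refl)) = a , inj₁ refl , inj₁ refl
  ShareEndpoint⇒commonEndpoint ((a , b) , _) _ (inj₁ (inj₂ refl)) = a , inj₁ refl , inj₂ refl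
  ShareEndpoint⇒commonEndpoint ((a , b) , _) _ (inj₂ (inj₁ refl)) = b , inj₂ refl , inj₁ refl
  ShareEndpoint⇒commonEndpoint ((a , b) , _) _ (inj₂ (inj₂ refl)) = b , inj₂ refl , inj₂ refl

  Endpoint-near : ∀ {x y} ed → Endpoint x ed → Endpoint y ed → Near x y
  Endpoint-near _             (inj₁ refl) (inj₁ refl) = inj₁ refl
  Endpoint-near (_ , _ , p~q) (inj₁ refl) (inj₂ refl) = inj₂ p~q
  Endpoint-near (_ , _ , p~q) (inj₂ refl) (inj₁ refl) = inj₂ (Adj-sym Γ p~q)
  Endpoint-near _             (inj₂ refl) (inj₂ refl) = inj₁ refl

  incidentEdge : ∀ {x y} → Adj Γ x y → ∃[ ed ] Endpoint x ed
  incidentEdge {x} {y} x~y with <-cmp x y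
  ... | tri< x<y _ _  = ((x , y) , x<y , x~y) , inj₁ refl
  ... | tri≈ _ refl _ = ⊥-elim (subst T (irrefl Γ x) x~y)
  ... | tri> _ _ y<x  = ((y , x) , y<x , Adj-sym Γ x~y) , inj₂ refl

  Adjᴸ⇒commonEndpoint : ∀ {i j} → Adj L i j → ∃[ z ] (Endpoint z (to i) × Endpoint z (to j))
  Adjᴸ⇒commonEndpoint {i} {j} i~j =
    ShareEndpoint⇒commonEndpoint (to i) (to j) (proj₂ (Equivalence.to (isLine i j) i~j))

  lineWalk⇒Walk≤ : ∀ {i j l x y} → Walk L i j l → Endpoint x (to i) → Endpoint y (to j) →
    Walk≤ x y (suc l)
  lineWalk⇒Walk≤ {i} here x∈i y∈i = Near⇒Walk≤1 (Endpoint-near (to i) x∈i y∈i)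
  lineWalk⇒Walk≤ {i} (step i~k rest) x∈i y∈j with Adjᴸ⇒commonEndpoint i~k
  ... | z , z∈i , z∈k = Near⇒Walk≤1 (Endpoint-near (to i) x∈i z∈i) ++≤ lineWalk⇒Walk≤ rest z∈k y∈j

  Global⇒nearEndpoint : ∀ {S x} → Global L S → ∀ ed → Endpoint x ed →
    ∃[ a ] (a ∈ S × ∃[ z ] (Endpoint z (to a) × Near x z))
  Global⇒nearEndpoint {S} {x} global ed x∈ed with from ed ∈? S
  ... | yes i∈S = from ed , i∈S , x , subst (Endpoint x) (≡-sym (strictlyInverseˡ ed)) x∈ed , inj₁ refl
  ... | no i∉S with global (from ed) i∉S
  ...   | a , a∈S , a~i with Adjᴸ⇒commonEndpoint a~i
  ...     | z , z∈a , z∈i =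
    a , a∈S , z , z∈a , Endpoint-near ed x∈ed (subst (Endpoint z) (strictlyInverseˡ ed) z∈i)

  lineGlobalConnected⇒Walk≤ : ∀ {S} → Global L S → InducedConnected L S →
    ∀ {u v} → ∃[ e₁ ] Endpoint u e₁ → ∃[ e₂ ] Endpoint v e₂ → Walk≤ u v (suc (suc ∣ S ∣))
  lineGlobalConnected⇒Walk≤ {S} global connected (e₁ , u∈e₁) (e₂ , v∈e₂)
    with Global⇒nearEndpoint global e₁ u∈e₁ | Global⇒nearEndpoint global e₂ v∈e₂
  ... | a , a∈S , z , z∈a , u~z | b , b∈S , z′ , z′∈b , v~z′
    with Walks.WalkIn⇒Walk< L (connected a b a∈S b∈S)
  ...   | l , p , l<∣S∣ =
    Walk≤-weaken (s≤s (s≤s (≤-trans (≤-reflexive (+-comm l 1)) l<∣S∣)))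
      ((Near⇒Walk≤1 u~z ++≤ lineWalk⇒Walk≤ p z∈a z′∈b) ++≤ Near⇒Walk≤1 (Near-sym v~z′))

  diameter≤2+∣S∣ : ∀ {D S} → IsDiameter Γ D → Global L S → InducedConnected L S →
    D ≤ suc (suc ∣ S ∣)
  diameter≤2+∣S∣ {S = S} diameter global connected = diameter≤ diameter bound
    where
    bound : ∀ {u v l} → Walk Γ u v l → Walk≤ u v (suc (suc ∣ S ∣))
    bound here = 0 , here , z≤n
    bound (step u~w rest) with Walk-lastStep (step u~w rest)
    ... | _ , y~v = lineGlobalConnected⇒Walk≤ global connected
                      (incidentEdge u~w) (incidentEdge (Adj-sym Γ y~v))

γca[L]≥⌈√[D+m-1]⌉∸1 : ∀ {n m} (Γ : Graph n) {D} → IsDiameter Γ D →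
  ∀ (L : Graph m) (e : Fin m ↔ Edge Γ) → IsLineGraphVia Γ L e →
  ∀ k → IsCeilSqrt (D + m ∸ 1) k → GammaCaAtLeast L (k ∸ 1)
γca[L]≥⌈√[D+m-1]⌉∸1 {m = m} Γ {D} diameter L e isLine k ceil S (alliance , global , connected) =
  IsCeilSqrt⇒∸1≤ ceil (∸-monoˡ-≤ 1 (begin
    D + m                                   ≤⟨ +-mono-≤ D≤2+∣S∣ (order≤∣S∣+∣S∣² L alliance global) ⟩
    suc (suc ∣ S ∣ + (∣ S ∣ + ∣ S ∣ * ∣ S ∣)) ≡⟨ cong suc (suc[s]+s+s*s≡suc[s]² ∣ S ∣) ⟩
    suc (suc ∣ S ∣ * suc ∣ S ∣)             ∎))
  where
  open ≤-Reasoning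
  D≤2+∣S∣ : D ≤ suc (suc ∣ S ∣)
  D≤2+∣S∣ = LineGraph.diameter≤2+∣S∣ Γ L e isLine diameter global connected

mainTheorem8 : ∀ {n m} (Γ : Graph n) (D : ℕ) → Connected Γ → IsDiameter Γ D →
    (∀ k → IsCeilSqrt (D + n) k → GammaCaAtLeast Γ (k ∸ 1)) ×
    (∀ (L : Graph m) (e : Fin m ↔ Edge Γ) → IsLineGraphVia Γ L e →
      ∀ k → IsCeilSqrt (D + m ∸ 1) k → GammaCaAtLeast L (k ∸ 1))
mainTheorem8 Γ _ _ diameter = γca≥⌈√[D+n]⌉∸1 Γ diameter , γca[L]≥⌈√[D+m-1]⌉∸1 Γ diameter
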